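{- For every Young diagram $\lambda$, $$\sum_{u\in\lambda} h(u)^2 \;\ge\; \sum_{u\in\lambda} \bigl(h^\ast(u)\bigr)^2 .$$
   Context: Let $\lambda=(\lambda_1\ge\dots\ge\lambda_\ell>0)$ be an integer partition, and $\lambda'$ its conjugate partition. The Young diagram of $\lambda$ is the set of squares $(i,j)$ with $1\le i\le \ell$ and $1\le j\le\lambda_i$; we write $u=(i,j)\in\lambda$. The hook length is $h(i,j)=\lambda_i-i+\lambda'_j-j+1$, the number of squares of $\lambda$ directly to the right of or directly below $(i,j)$, including $(i,j)$. The anti-hook length is $h^\ast(i,j)=i+j-1$. -}

module Defs where

open import Data.Nat using (ℕ; zero; suc; _+_; _*_; _∸_; _≤_; _<_; _≥_; _≤ᵇ_)
open import Data.List using (List; []; _∷_; length; map; upTo)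
open import Data.Nat.ListAction using (sum)
open import Data.List.Relation.Unary.All using (All)
open import Data.List.Relation.Unary.Linked using (Linked)
open import Data.Bool using (if_then_else_)

record Partition : Set where
  constructor mkPartition
  field
    parts    : List ℕ
    weakDec  : Linked _≥_ parts
    positive : All (λ p → 0 < p) parts
open Partition public

-- λ_i for 1-indexed i (0 outside 1..ℓ).
row : List ℕ → ℕ → ℕ
row []       _             = 0
row (p ∷ ps) zero          = 0
row (p ∷ ps) (suc zero)    = p
row (p ∷ ps) (suc (suc i)) = row ps (suc i)

col : List ℕ → ℕ → ℕ
col []       j = 0
col (p ∷ ps) j = (if j ≤ᵇ p then 1 else 0) + col ps j

-- hook length h(i,j) = λ_i - i + λ'_j - j + 1 (for cells of λ this is a natural number)
hook : Partition → ℕ → ℕ → ℕ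
hook μ i j = ((row (parts μ) i + col (parts μ) j + 1) ∸ i) ∸ j

antiHook : ℕ → ℕ → ℕ
antiHook i j = (i + j) ∸ 1

range1 : ℕ → List ℕ
range1 n = map suc (upTo n)

sumCells : Partition → (ℕ → ℕ → ℕ) → ℕ
sumCells μ f =
  sum (map (λ i → sum (map (λ j → f i j) (range1 (row (parts μ) i))))
           (range1 (length (parts μ))))

-- Peeling off the first row λ₁ = a of λ expresses both sums recursively: the hooks of
-- row 1 are (a + 1 − j) + λ'_j and the other hooks are those of the remaining partition,
-- while every anti-hook below row 1 grows by one. Comparing the recurrences gives the identity
--   Σ h(u)² + Σᵢ (2i − 1) λᵢ² = n² + Σ h*(u)²,   n = |λ|,
-- and since the parts decrease, n² = Σᵢ λᵢ² + 2 Σ_{i<k} λᵢ λₖ ≥ Σₖ (2k − 1) λₖ².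
module Submission where

open import Defs
open import Data.Nat using (ℕ; zero; suc; _+_; _*_; _∸_; _≤_; _<_; _≥_; _≤ᵇ_; z≤n; s≤s; z<s; s<s)
open import Data.Nat.Properties
open import Algebra.Properties.CommutativeSemigroup +-commutativeSemigroup using (interchange; xy∙z≈xz∙y)
open import Data.Nat.ListAction using (sum)
open import Data.Nat.Tactic.RingSolver using (solve-∀)
open import Data.List using (List; []; _∷_; length; map; applyUpTo)
open import Data.List.Relation.Unary.All using (All; []; _∷_)
open import Data.List.Relation.Unary.Linked as Linked using (Linked; _∷_)
open import Data.List.Relation.Unary.Linked.Properties using (Linked⇒All)
open import Data.Bool using (if_then_else_; true; false)
open import Relation.Binary.PropositionalEquality
open ≡-Reasoning

∑ : ℕ → (ℕ → ℕ) → ℕ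
∑ zero    f = 0
∑ (suc n) f = f 1 + ∑ n (λ j → f (suc j))

sum-range1 : ∀ n g → sum (map g (range1 n)) ≡ ∑ n g
sum-range1 n g = sum-shifted n (λ i → i) g (λ _ → refl)
  where
  sum-shifted : ∀ n h G → (∀ j → G (suc j) ≡ g (suc (h j))) →
                sum (map g (map suc (applyUpTo h n))) ≡ ∑ n G
  sum-shifted zero    h G eq = refl
  sum-shifted (suc n) h G eq =
    cong₂ _+_ (sym (eq 0)) (sum-shifted n (λ i → h (suc i)) (λ j → G (suc j)) (λ j → eq (suc j)))

∑-cong : ∀ n {f g : ℕ → ℕ} → (∀ k → k < n → f (suc k) ≡ g (suc k)) → ∑ n f ≡ ∑ n g
∑-cong zero    eq = refl
∑-cong (suc n) eq = cong₂ _+_ (eq 0 z<s) (∑-cong n (λ k k<n → eq (suc k) (s<s k<n)))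

∑-+ : ∀ n f g → ∑ n (λ j → f j + g j) ≡ ∑ n f + ∑ n g
∑-+ zero    f g = refl
∑-+ (suc n) f g =
  trans (cong (f 1 + g 1 +_) (∑-+ n (λ j → f (suc j)) (λ j → g (suc j))))
        (interchange (f 1) (g 1) _ _)

∑-* : ∀ n c f → ∑ n (λ j → c * f j) ≡ c * ∑ n f
∑-* zero    c f = sym (*-zeroʳ c)
∑-* (suc n) c f =
  trans (cong (c * f 1 +_) (∑-* n c (λ j → f (suc j)))) (sym (*-distribˡ-+ c (f 1) _))

∑-const : ∀ n c → ∑ n (λ _ → c) ≡ n * c
∑-const zero    c = refl
∑-const (suc n) c = cong (c +_) (∑-const n c)

∑-snoc : ∀ n f → ∑ (suc n) f ≡ ∑ n f + f (suc n)
∑-snoc zero    f = +-comm (f 1) 0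
∑-snoc (suc n) f = trans (cong (f 1 +_) (∑-snoc n (λ j → f (suc j)))) (sym (+-assoc (f 1) _ _))

∑-reverse : ∀ n f → ∑ n (λ j → f (suc n ∸ j)) ≡ ∑ n f
∑-reverse zero    f = refl
∑-reverse (suc n) f = begin
  f (suc n) + ∑ n (λ j → f (suc n ∸ j)) ≡⟨ cong (f (suc n) +_) (∑-reverse n f) ⟩
  f (suc n) + ∑ n f                     ≡⟨ +-comm (f (suc n)) (∑ n f) ⟩
  ∑ n f + f (suc n)                     ≡⟨ ∑-snoc n f ⟨
  ∑ (suc n) f                           ∎

∑-id : ∀ n → 2 * ∑ n (λ j → j) ≡ n + n * n
∑-id zero    = refl
∑-id (suc n) = begin
  2 * ∑ (suc n) (λ j → j)       ≡⟨ cong (2 *_) (∑-snoc n (λ j → j)) ⟩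
  2 * (∑ n (λ j → j) + suc n)   ≡⟨ *-distribˡ-+ 2 (∑ n (λ j → j)) (suc n) ⟩
  2 * ∑ n (λ j → j) + 2 * suc n ≡⟨ cong (_+ 2 * suc n) (∑-id n) ⟩
  n + n * n + 2 * suc n         ≡⟨ expand n ⟩
  suc n + suc n * suc n         ∎
  where
  expand : ∀ n → n + n * n + 2 * suc n ≡ suc n + suc n * suc n
  expand = solve-∀

∑-0 : ∀ n → ∑ n (λ _ → 0) ≡ 0
∑-0 n = trans (∑-const n 0) (*-zeroʳ n)

square-+ : ∀ x y → (x + y) * (x + y) ≡ x * x + 2 * (x * y) + y * y
square-+ = solve-∀

𝟙[_≤_] : ℕ → ℕ → ℕ
𝟙[ j ≤ a ] = if j ≤ᵇ a then 1 else 0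

𝟙-< : ∀ {k a} → k < a → 𝟙[ suc k ≤ a ] ≡ 1
𝟙-< {zero}  {suc a} _         = refl
𝟙-< {suc k} {suc a} (s<s k<a) = 𝟙-< k<a

𝟙-idem : ∀ j a → 𝟙[ j ≤ a ] * 𝟙[ j ≤ a ] ≡ 𝟙[ j ≤ a ]
𝟙-idem j a with j ≤ᵇ a
... | true  = refl
... | false = refl

∑-𝟙* : ∀ {b n} g → b ≤ n → ∑ n (λ j → 𝟙[ j ≤ b ] * g j) ≡ ∑ b g
∑-𝟙* {zero}  {n}     g _         = trans (∑-cong n (λ _ _ → refl)) (∑-0 n)
∑-𝟙* {suc b} {suc n} g (s≤s b≤n) =
  cong₂ _+_ (+-identityʳ (g 1)) (trans (∑-cong n (λ _ _ → refl)) (∑-𝟙* (λ j → g (suc j)) b≤n))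

∑-𝟙 : ∀ {b n} → b ≤ n → ∑ n (λ j → 𝟙[ j ≤ b ]) ≡ b
∑-𝟙 {b} {n} b≤n = begin
  ∑ n (λ j → 𝟙[ j ≤ b ])     ≡⟨ ∑-cong n (λ k _ → sym (*-identityʳ 𝟙[ suc k ≤ b ])) ⟩
  ∑ n (λ j → 𝟙[ j ≤ b ] * 1) ≡⟨ ∑-𝟙* (λ _ → 1) b≤n ⟩
  ∑ b (λ _ → 1)              ≡⟨ ∑-const b 1 ⟩
  b * 1                      ≡⟨ *-identityʳ b ⟩
  b                          ∎

∑-col : ∀ {a ps} → All (_≤ a) ps → ∑ a (col ps) ≡ sum ps
∑-col {a} {[]}     []           = ∑-0 a
∑-col {a} {b ∷ ps} (b≤a ∷ ps≤a) =
  trans (∑-+ a (λ j → 𝟙[ j ≤ b ]) (col ps)) (cong₂ _+_ (∑-𝟙 b≤a) (∑-col ps≤a))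

row-≤ : ∀ {a ps} → All (_≤ a) ps → ∀ i → row ps i ≤ a
row-≤ []         _             = z≤n
row-≤ (_ ∷ _)    zero          = z≤n
row-≤ (p≤a ∷ _)  (suc zero)    = p≤a
row-≤ (_ ∷ ps≤a) (suc (suc i)) = row-≤ ps≤a (suc i)

head-≥-All : ∀ {b ps} → Linked _≥_ (b ∷ ps) → All (_≤ b) ps
head-≥-All {ps = []}    _            = []
head-≥-All {ps = _ ∷ _} (b≥c ∷ rest) = Linked⇒All (λ b≥c c≥d → ≤-trans c≥d b≥c) b≥c rest

∑cells : List ℕ → (ℕ → ℕ → ℕ) → ℕ
∑cells []       f = 0
∑cells (a ∷ ps) f = ∑ a (f 1) + ∑cells ps (λ i → f (suc i))

sumCells≡∑cells : ∀ μ f → sumCells μ f ≡ ∑cells (parts μ) f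
sumCells≡∑cells μ f = begin
  sumCells μ f
    ≡⟨ sum-range1 (length ps) _ ⟩
  ∑ (length ps) (λ i → sum (map (f i) (range1 (row ps i))))
    ≡⟨ ∑-cong (length ps) (λ i _ → sum-range1 (row ps (suc i)) (f (suc i))) ⟩
  ∑ (length ps) (λ i → ∑ (row ps i) (f i))
    ≡⟨ ∑-rows ps f ⟩
  ∑cells ps f
    ∎
  where
  ps : List ℕ
  ps = parts μ

  ∑-rows : ∀ ps f → ∑ (length ps) (λ i → ∑ (row ps i) (f i)) ≡ ∑cells ps f
  ∑-rows []       f = refl
  ∑-rows (a ∷ ps) f = cong (∑ a (f 1) +_)
    (trans (∑-cong (length ps) (λ _ _ → refl)) (∑-rows ps (λ i → f (suc i))))

∑cells-cong : ∀ ps {f g} → (∀ i k → k < row ps (suc i) → f (suc i) (suc k) ≡ g (suc i) (suc k)) →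
              ∑cells ps f ≡ ∑cells ps g
∑cells-cong []       eq = refl
∑cells-cong (a ∷ ps) eq = cong₂ _+_ (∑-cong a (eq 0)) (∑cells-cong ps (λ i → eq (suc i)))

∑cells-+ : ∀ ps f g → ∑cells ps (λ i j → f i j + g i j) ≡ ∑cells ps f + ∑cells ps g
∑cells-+ []       f g = refl
∑cells-+ (a ∷ ps) f g =
  trans (cong₂ _+_ (∑-+ a (f 1) (g 1)) (∑cells-+ ps (λ i → f (suc i)) (λ i → g (suc i))))
        (interchange (∑ a (f 1)) (∑ a (g 1)) _ _)

∑cells-* : ∀ ps c f → ∑cells ps (λ i j → c * f i j) ≡ c * ∑cells ps f
∑cells-* []       c f = sym (*-zeroʳ c)
∑cells-* (a ∷ ps) c f =
  trans (cong₂ _+_ (∑-* a c (f 1)) (∑cells-* ps c (λ i → f (suc i)))) (sym (*-distribˡ-+ c _ _))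

∑cells-1 : ∀ ps → ∑cells ps (λ _ _ → 1) ≡ sum ps
∑cells-1 []       = refl
∑cells-1 (a ∷ ps) = cong₂ _+_ (trans (∑-const a 1) (*-identityʳ a)) (∑cells-1 ps)

hookᴸ : List ℕ → ℕ → ℕ → ℕ
hookᴸ ps i j = ((row ps i + col ps j + 1) ∸ i) ∸ j

hook-head : ∀ {a ps k} → k < a → hookᴸ (a ∷ ps) 1 (suc k) ≡ (a ∸ k) + col ps (suc k)
hook-head {a} {ps} {k} k<a = begin
  (a + (𝟙[ suc k ≤ a ] + c) + 1) ∸ 1 ∸ suc k ≡⟨ cong (λ t → (a + (t + c) + 1) ∸ 1 ∸ suc k) (𝟙-< k<a) ⟩
  (a + suc c + 1) ∸ 1 ∸ suc k                ≡⟨ cong (_∸ suc k) (m+n∸n≡m (a + suc c) 1) ⟩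
  (a + suc c) ∸ suc k                        ≡⟨ cong (_∸ suc k) (+-suc a c) ⟩
  (a + c) ∸ k                                ≡⟨ +-∸-comm c (<⇒≤ k<a) ⟩
  (a ∸ k) + c                                ∎
  where c = col ps (suc k)

hook-tail : ∀ {a ps i k} → k < a → hookᴸ (a ∷ ps) (suc (suc i)) (suc k) ≡ hookᴸ ps (suc i) (suc k)
hook-tail {a} {ps} {i} {k} k<a rewrite 𝟙-< k<a | +-suc (row ps (suc i)) (col ps (suc k)) = refl

antiHook-suc : ∀ i j → antiHook (suc (suc i)) j ≡ antiHook (suc i) j + 1
antiHook-suc i j = sym (+-comm (i + j) 1)

hookSquareSum : List ℕ → ℕ
hookSquareSum ps = ∑cells ps (λ i j → hookᴸ ps i j * hookᴸ ps i j)

antiHookSquareSum : List ℕ → ℕ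
antiHookSquareSum ps = ∑cells ps (λ i j → antiHook i j * antiHook i j)

antiHookSum : List ℕ → ℕ
antiHookSum ps = ∑cells ps antiHook

-- (a + 1 − j) and λ'_j are the arm + 1 and the leg of the cell (1, j) of a ∷ ps.
crossSum : ℕ → List ℕ → ℕ
crossSum a ps = ∑ a (λ j → (suc a ∸ j) * col ps j)

colSquareSum : ℕ → List ℕ → ℕ
colSquareSum a ps = ∑ a (λ j → col ps j * col ps j)

hookSquareSum-∷ : ∀ {a ps} → All (_≤ a) ps →
  hookSquareSum (a ∷ ps) ≡ ∑ a (λ j → j * j) + 2 * crossSum a ps + colSquareSum a ps + hookSquareSum ps
hookSquareSum-∷ {a} {ps} ps≤a = cong₂ _+_ firstRow
  (∑cells-cong ps (λ i k k<r → cong (λ x → x * x) (hook-tail {a} {ps} {i} (≤-trans k<r (row-≤ ps≤a (suc i))))))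
  where
  d : ℕ → ℕ
  d j = suc a ∸ j
  firstRow : ∑ a (λ j → hookᴸ (a ∷ ps) 1 j * hookᴸ (a ∷ ps) 1 j)
           ≡ ∑ a (λ j → j * j) + 2 * crossSum a ps + colSquareSum a ps
  firstRow = begin
    ∑ a (λ j → hookᴸ (a ∷ ps) 1 j * hookᴸ (a ∷ ps) 1 j)
      ≡⟨ ∑-cong a (λ k k<a → trans (cong (λ x → x * x) (hook-head {a} {ps} k<a)) (square-+ (a ∸ k) (col ps (suc k)))) ⟩
    ∑ a (λ j → d j * d j + 2 * (d j * col ps j) + col ps j * col ps j)
      ≡⟨ ∑-+ a _ (λ j → col ps j * col ps j) ⟩
    ∑ a (λ j → d j * d j + 2 * (d j * col ps j)) + colSquareSum a ps
      ≡⟨ cong (_+ colSquareSum a ps) (∑-+ a (λ j → d j * d j) _) ⟩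
    ∑ a (λ j → d j * d j) + ∑ a (λ j → 2 * (d j * col ps j)) + colSquareSum a ps
      ≡⟨ cong (λ t → t + colSquareSum a ps)
           (cong₂ _+_ (∑-reverse a (λ j → j * j)) (∑-* a 2 (λ j → d j * col ps j))) ⟩
    ∑ a (λ j → j * j) + 2 * crossSum a ps + colSquareSum a ps
      ∎

antiHookSquareSum-∷ : ∀ a ps →
  antiHookSquareSum (a ∷ ps) ≡ ∑ a (λ j → j * j) + (antiHookSquareSum ps + 2 * antiHookSum ps + sum ps)
antiHookSquareSum-∷ a ps = cong (∑ a (λ j → j * j) +_) (begin
  ∑cells ps (λ i j → antiHook (suc i) j * antiHook (suc i) j)
    ≡⟨ ∑cells-cong ps (λ i k _ → trans (cong (λ x → x * x) (antiHook-suc i (suc k)))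
                                        (square-suc (antiHook (suc i) (suc k)))) ⟩
  ∑cells ps (λ i j → antiHook i j * antiHook i j + 2 * antiHook i j + 1)
    ≡⟨ ∑cells-+ ps _ (λ _ _ → 1) ⟩
  ∑cells ps (λ i j → antiHook i j * antiHook i j + 2 * antiHook i j) + ∑cells ps (λ _ _ → 1)
    ≡⟨ cong₂ _+_ (trans (∑cells-+ ps _ _) (cong (antiHookSquareSum ps +_) (∑cells-* ps 2 antiHook)))
                 (∑cells-1 ps) ⟩
  antiHookSquareSum ps + 2 * antiHookSum ps + sum ps
    ∎)
  where
  square-suc : ∀ x → (x + 1) * (x + 1) ≡ x * x + 2 * x + 1
  square-suc = solve-∀

antiHookSum-∷ : ∀ a ps → antiHookSum (a ∷ ps) ≡ ∑ a (λ j → j) + (antiHookSum ps + sum ps)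
antiHookSum-∷ a ps = cong (∑ a (λ j → j) +_)
  (trans (∑cells-cong ps (λ i k _ → antiHook-suc i (suc k)))
         (trans (∑cells-+ ps antiHook (λ _ _ → 1)) (cong (antiHookSum ps +_) (∑cells-1 ps))))

squareSum : List ℕ → ℕ
squareSum ps = sum (map (λ p → p * p) ps)

crossSum-∷ : ∀ {a b} ps → b ≤ a → crossSum a (b ∷ ps) ≡ ∑ b (λ j → suc a ∸ j) + crossSum a ps
crossSum-∷ {a} {b} ps b≤a = begin
  ∑ a (λ j → d j * (𝟙[ j ≤ b ] + col ps j))
    ≡⟨ ∑-cong a (λ k _ → distrib (d (suc k)) 𝟙[ suc k ≤ b ] (col ps (suc k))) ⟩
  ∑ a (λ j → 𝟙[ j ≤ b ] * d j + d j * col ps j)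
    ≡⟨ ∑-+ a (λ j → 𝟙[ j ≤ b ] * d j) _ ⟩
  ∑ a (λ j → 𝟙[ j ≤ b ] * d j) + crossSum a ps
    ≡⟨ cong (_+ crossSum a ps) (∑-𝟙* d b≤a) ⟩
  ∑ b d + crossSum a ps
    ∎
  where
  d : ℕ → ℕ
  d j = suc a ∸ j
  distrib : ∀ x y z → x * (y + z) ≡ y * x + x * z
  distrib x y z = trans (*-distribˡ-+ x y z) (cong (_+ x * z) (*-comm x y))

colSquareSum-∷ : ∀ {a b ps} → b ≤ a → All (_≤ b) ps →
  colSquareSum a (b ∷ ps) ≡ b + 2 * sum ps + colSquareSum a ps
colSquareSum-∷ {a} {b} {ps} b≤a ps≤b = begin
  ∑ a (λ j → (𝟙[ j ≤ b ] + col ps j) * (𝟙[ j ≤ b ] + col ps j))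
    ≡⟨ ∑-cong a (λ k _ → expand (suc k)) ⟩
  ∑ a (λ j → 𝟙[ j ≤ b ] + 2 * (𝟙[ j ≤ b ] * col ps j) + col ps j * col ps j)
    ≡⟨ ∑-+ a _ (λ j → col ps j * col ps j) ⟩
  ∑ a (λ j → 𝟙[ j ≤ b ] + 2 * (𝟙[ j ≤ b ] * col ps j)) + colSquareSum a ps
    ≡⟨ cong (_+ colSquareSum a ps) (∑-+ a (λ j → 𝟙[ j ≤ b ]) _) ⟩
  ∑ a (λ j → 𝟙[ j ≤ b ]) + ∑ a (λ j → 2 * (𝟙[ j ≤ b ] * col ps j)) + colSquareSum a ps
    ≡⟨ cong (λ t → ∑ a (λ j → 𝟙[ j ≤ b ]) + t + colSquareSum a ps) (∑-* a 2 _) ⟩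
  ∑ a (λ j → 𝟙[ j ≤ b ]) + 2 * ∑ a (λ j → 𝟙[ j ≤ b ] * col ps j) + colSquareSum a ps
    ≡⟨ cong₂ (λ s t → s + 2 * t + colSquareSum a ps) (∑-𝟙 b≤a) (trans (∑-𝟙* (col ps) b≤a) (∑-col ps≤b)) ⟩
  b + 2 * sum ps + colSquareSum a ps
    ∎
  where
  expand : ∀ j → (𝟙[ j ≤ b ] + col ps j) * (𝟙[ j ≤ b ] + col ps j)
               ≡ 𝟙[ j ≤ b ] + 2 * (𝟙[ j ≤ b ] * col ps j) + col ps j * col ps j
  expand j = trans (square-+ 𝟙[ j ≤ b ] (col ps j))
    (cong (λ t → t + 2 * (𝟙[ j ≤ b ] * col ps j) + col ps j * col ps j) (𝟙-idem j b))

∑-∸-balance : ∀ {a b} → b ≤ a → ∑ b (λ j → suc a ∸ j) + b * b ≡ a * b + ∑ b (λ j → j)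
∑-∸-balance {a} {b} b≤a = +-cancelʳ-≡ T _ _ (begin
  P + b * b + T       ≡⟨ xy∙z≈xz∙y P (b * b) T ⟩
  P + T + b * b       ≡⟨ cong (_+ b * b) rectangle ⟩
  b * suc a + b * b   ≡⟨ expand a b ⟩
  a * b + (b + b * b) ≡⟨ cong (a * b +_) (∑-id b) ⟨
  a * b + 2 * T       ≡⟨ double (a * b) T ⟩
  a * b + T + T       ∎)
  where
  P T : ℕ
  P = ∑ b (λ j → suc a ∸ j)
  T = ∑ b (λ j → j)
  rectangle : P + T ≡ b * suc a
  rectangle = begin
    P + T                         ≡⟨ ∑-+ b (λ j → suc a ∸ j) (λ j → j) ⟨
    ∑ b (λ j → (suc a ∸ j) + j)   ≡⟨ ∑-cong b (λ k k<b → m∸n+n≡m (≤-trans k<b (m≤n⇒m≤1+n b≤a))) ⟩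
    ∑ b (λ _ → suc a)             ≡⟨ ∑-const b (suc a) ⟩
    b * suc a                     ∎
  expand : ∀ a b → b * suc a + b * b ≡ a * b + (b + b * b)
  expand = solve-∀
  double : ∀ x y → x + 2 * y ≡ x + y + y
  double = solve-∀

crossSum-identity : ∀ {a ps} → All (_≤ a) ps → Linked _≥_ ps →
  2 * crossSum a ps + colSquareSum a ps + 2 * squareSum ps ≡ 2 * a * sum ps + 2 * antiHookSum ps + sum ps
crossSum-identity {a} {[]} _ _ = begin
  2 * crossSum a [] + colSquareSum a [] + 0
    ≡⟨ cong (λ t → 2 * t + colSquareSum a [] + 0) (trans (∑-cong a (λ k _ → *-zeroʳ (suc a ∸ suc k))) (∑-0 a)) ⟩
  2 * 0 + ∑ a (λ _ → 0) + 0 ≡⟨ cong (_+ 0) (∑-0 a) ⟩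
  0                         ≡⟨ cong (λ t → t + 0 + 0) (*-zeroʳ (2 * a)) ⟨
  2 * a * 0 + 0 + 0         ∎
crossSum-identity {a} {b ∷ ps} (b≤a ∷ ps≤a) ps↓ = begin
  2 * crossSum a (b ∷ ps) + colSquareSum a (b ∷ ps) + 2 * (b * b + Q)
    ≡⟨ cong₂ (λ x y → 2 * x + y + 2 * (b * b + Q)) (crossSum-∷ ps b≤a) (colSquareSum-∷ b≤a ps≤b) ⟩
  2 * (P + X) + (b + 2 * m + Y) + 2 * (b * b + Q)
    ≡⟨ regroup P X Y Q b m ⟩
  (2 * X + Y + 2 * Q) + 2 * (P + b * b) + (b + 2 * m)
    ≡⟨ cong₂ (λ s t → s + 2 * t + (b + 2 * m)) (crossSum-identity ps≤a (Linked.tail ps↓)) (∑-∸-balance b≤a) ⟩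
  (2 * a * m + 2 * S + m) + 2 * (a * b + T) + (b + 2 * m)
    ≡⟨ regroup′ a b m S T ⟩
  2 * a * (b + m) + 2 * (T + (S + m)) + (b + m)
    ≡⟨ cong (λ t → 2 * a * (b + m) + 2 * t + (b + m)) (antiHookSum-∷ b ps) ⟨
  2 * a * (b + m) + 2 * antiHookSum (b ∷ ps) + (b + m)
    ∎
  where
  ps≤b : All (_≤ b) ps
  ps≤b = head-≥-All ps↓
  P T X Y Q S m : ℕ
  P = ∑ b (λ j → suc a ∸ j)
  T = ∑ b (λ j → j)
  X = crossSum a ps
  Y = colSquareSum a ps
  Q = squareSum ps
  S = antiHookSum ps
  m = sum ps
  regroup : ∀ P X Y Q b m →
    2 * (P + X) + (b + 2 * m + Y) + 2 * (b * b + Q) ≡ (2 * X + Y + 2 * Q) + 2 * (P + b * b) + (b + 2 * m)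
  regroup = solve-∀
  regroup′ : ∀ a b m S T →
    (2 * a * m + 2 * S + m) + 2 * (a * b + T) + (b + 2 * m) ≡ 2 * a * (b + m) + 2 * (T + (S + m)) + (b + m)
  regroup′ = solve-∀

-- Σᵢ (2i − 1) λᵢ²
oddWeightedSquareSum : List ℕ → ℕ
oddWeightedSquareSum []       = 0
oddWeightedSquareSum (a ∷ ps) = a * a + oddWeightedSquareSum ps + 2 * squareSum ps

hookSquareSum+oddWeightedSquareSum : ∀ {ps} → Linked _≥_ ps →
  hookSquareSum ps + oddWeightedSquareSum ps ≡ sum ps * sum ps + antiHookSquareSum ps
hookSquareSum+oddWeightedSquareSum {[]}     _   = refl
hookSquareSum+oddWeightedSquareSum {a ∷ ps} ps↓ = begin
  hookSquareSum (a ∷ ps) + (a * a + W + 2 * Q)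
    ≡⟨ cong (_+ (a * a + W + 2 * Q)) (hookSquareSum-∷ ps≤a) ⟩
  (R + 2 * X + Y + H) + (a * a + W + 2 * Q)
    ≡⟨ regroup R X Y H W Q a ⟩
  R + a * a + (H + W) + (2 * X + Y + 2 * Q)
    ≡⟨ cong₂ (λ s t → R + a * a + s + t) (hookSquareSum+oddWeightedSquareSum (Linked.tail ps↓))
                                         (crossSum-identity ps≤a (Linked.tail ps↓)) ⟩
  R + a * a + (m * m + A) + (2 * a * m + 2 * S + m)
    ≡⟨ regroup′ R a m A S ⟩
  (a + m) * (a + m) + (R + (A + 2 * S + m))
    ≡⟨ cong ((a + m) * (a + m) +_) (antiHookSquareSum-∷ a ps) ⟨
  (a + m) * (a + m) + antiHookSquareSum (a ∷ ps)
    ∎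
  where
  ps≤a : All (_≤ a) ps
  ps≤a = head-≥-All ps↓
  R X Y H W Q A S m : ℕ
  R = ∑ a (λ j → j * j)
  X = crossSum a ps
  Y = colSquareSum a ps
  H = hookSquareSum ps
  W = oddWeightedSquareSum ps
  Q = squareSum ps
  A = antiHookSquareSum ps
  S = antiHookSum ps
  m = sum ps
  regroup : ∀ R X Y H W Q a →
    (R + 2 * X + Y + H) + (a * a + W + 2 * Q) ≡ R + a * a + (H + W) + (2 * X + Y + 2 * Q)
  regroup = solve-∀
  regroup′ : ∀ R a m A S →
    R + a * a + (m * m + A) + (2 * a * m + 2 * S + m) ≡ (a + m) * (a + m) + (R + (A + 2 * S + m))
  regroup′ = solve-∀

squareSum-≤ : ∀ {a ps} → All (_≤ a) ps → squareSum ps ≤ a * sum ps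
squareSum-≤ {a} {[]}     []           = z≤n
squareSum-≤ {a} {b ∷ ps} (b≤a ∷ ps≤a) =
  ≤-trans (+-mono-≤ (*-monoˡ-≤ b b≤a) (squareSum-≤ ps≤a)) (≤-reflexive (sym (*-distribˡ-+ a b (sum ps))))

oddWeightedSquareSum-≤ : ∀ {ps} → Linked _≥_ ps → oddWeightedSquareSum ps ≤ sum ps * sum ps
oddWeightedSquareSum-≤ {[]}     _   = z≤n
oddWeightedSquareSum-≤ {a ∷ ps} ps↓ =
  ≤-trans (+-mono-≤ (+-monoʳ-≤ (a * a) (oddWeightedSquareSum-≤ (Linked.tail ps↓)))
                    (*-monoʳ-≤ 2 (squareSum-≤ (head-≥-All ps↓))))
          (≤-reflexive (trans (xy∙z≈xz∙y (a * a) _ _) (sym (square-+ a (sum ps)))))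

corollary1p4 : (μ : Partition) →
    sumCells μ (λ i j → hook μ i j * hook μ i j)
      ≥ sumCells μ (λ i j → antiHook i j * antiHook i j)
corollary1p4 μ =
  subst₂ _≤_ (sym (sumCells≡∑cells μ _)) (sym (sumCells≡∑cells μ _)) (+-cancelʳ-≤ W A H A+W≤H+W)
  where
  ps : List ℕ
  ps = parts μ
  H A W n : ℕ
  H = hookSquareSum ps
  A = antiHookSquareSum ps
  W = oddWeightedSquareSum ps
  n = sum ps
  A+W≤H+W : A + W ≤ H + W
  A+W≤H+W = ≤-trans (+-monoʳ-≤ A (oddWeightedSquareSum-≤ (weakDec μ)))
    (≤-reflexive (trans (+-comm A (n * n)) (sym (hookSquareSum+oddWeightedSquareSum (weakDec μ)))))
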